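{- Let $p\ge 2$ be an integer and let $C_n$ be the cycle on $n$ vertices. If $\gamma_p(C_n)>p$, then $r_p(C_n)=2$ if $p=2$ and $n$ is odd; $r_p(C_n)=4$ if $p=2$ and $n$ is even; and $r_p(C_n)=p-2$ if $p\ge 3$.
   Context: For a graph $G=(V,E)$, a set $D\subseteq V$ is a $p$-dominating set if every vertex $x\notin D$ has at least $p$ neighbours in $D$; $\gamma_p(G)$ is the minimum size of a $p$-dominating set. For $B\subseteq E(G^c)$ (edges of the complement), $G+B=(V,E\cup B)$. The $p$-reinforcement number is $r_p(G)=\min\{|B| : B\subseteq E(G^c),\ \gamma_p(G+B)<\gamma_p(G)\}$, with the convention $r_p(G)=0$ if $\gamma_p(G)\le p$. -}

module Defs where

open import Data.Nat using (ℕ; zero; suc; _≤_; _<_; _≡ᵇ_)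
open import Data.Bool using (Bool; true; false; _∨_; _∧_; if_then_else_)
open import Data.Fin using (Fin; toℕ)
open import Data.Fin.Subset using (Subset; ∣_∣)
open import Data.Vec using (lookup)
open import Data.List using (map; allFin)
open import Data.Nat.ListAction using (sum)
open import Data.Product using (Σ; _×_)
open import Relation.Binary.PropositionalEquality using (_≡_)

Graph : ℕ → Set
Graph n = Fin n → Fin n → Bool

IsSimple : ∀ {n} → Graph n → Set
IsSimple {n} G = (∀ (i j : Fin n) → G i j ≡ G j i) × (∀ (i : Fin n) → G i i ≡ false)

isSucc : (n : ℕ) → Fin n → Fin n → Bool
isSucc n i j = (suc (toℕ i) ≡ᵇ toℕ j) ∨ ((suc (toℕ i) ≡ᵇ n) ∧ (toℕ j ≡ᵇ 0))

-- The cycle C_n on vertices 0,...,n-1 (a simple graph for n ≥ 3).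
cycle : (n : ℕ) → Graph n
cycle n i j = isSucc n i j ∨ isSucc n j i

degIn : ∀ {n} → Graph n → Subset n → Fin n → ℕ
degIn {n} G D x = sum (map (λ y → if G x y ∧ lookup D y then 1 else 0) (allFin n))

IsPDom : ∀ {n} → ℕ → Graph n → Subset n → Set
IsPDom {n} p G D = ∀ (x : Fin n) → lookup D x ≡ false → p ≤ degIn G D x

IsGammaP : ∀ {n} → ℕ → Graph n → ℕ → Set
IsGammaP {n} p G k =
  (Σ (Subset n) λ D → IsPDom p G D × ∣ D ∣ ≡ k) ×
  (∀ (D : Subset n) → IsPDom p G D → k ≤ ∣ D ∣)

_+E_ : ∀ {n} → Graph n → Graph n → Graph n
(G +E B) i j = G i j ∨ B i j

IsComplEdgeSet : ∀ {n} → Graph n → Graph n → Set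
IsComplEdgeSet {n} G B = IsSimple B × (∀ (i j : Fin n) → B i j ≡ true → G i j ≡ false)

edgeCount : ∀ {n} → Graph n → ℕ
edgeCount {n} B =
  sum (map (λ i → sum (map (λ j → if (suc (toℕ i) Data.Nat.≤ᵇ toℕ j) ∧ B i j then 1 else 0) (allFin n))) (allFin n))

Reinforces : ∀ {n} → ℕ → Graph n → Graph n → Set
Reinforces p G B = Σ ℕ λ k → Σ ℕ λ k' → IsGammaP p G k × IsGammaP p (G +E B) k' × k' < k

-- r_p(G) = r, including the convention r_p(G) = 0 when γ_p(G) ≤ p.
IsReinforcementNumber : ∀ {n} → ℕ → Graph n → ℕ → Set
IsReinforcementNumber {n} p G r =
  (∀ k → IsGammaP p G k → k ≤ p → r ≡ 0) ×
  (∀ k → IsGammaP p G k → p < k →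
     (Σ (Graph n) λ B → IsComplEdgeSet G B × Reinforces p G B × edgeCount B ≡ r) ×
     (∀ (B : Graph n) → IsComplEdgeSet G B → Reinforces p G B → r ≤ edgeCount B))

module Submission where

-- For p ≥ 3 only V p-dominates C_n, so γ_p(C_n) = n; a reinforcing B leaves some vertex outside the
-- new dominating set, which needs p ≤ 2 + |B| neighbours, while the star joining n - 1 to 1, ..., p - 2
-- makes V ∖ {n - 1} p-dominating.
-- For p = 2, double counting the pairs leading into a 2-dominating set D of C_n + B gives
-- 2n ≤ 4|D| + |B|; with the alternating set, n/2 ≤ γ₂(C_n) ≤ (n + 1)/2, whence |B| ≥ 2, and |B| ≥ 4 for
-- even n. Explicit 2 (resp. 4) non-edges make the odd labels below n - 1 a 2-dominating set that is
-- smaller than γ₂(C_n).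

open import Defs
open import Data.Nat
open import Data.Nat.Properties
open import Data.Nat.DivMod using (_%_)
open import Data.Nat.ListAction using (sum)
open import Data.Bool using (Bool; true; false; _∨_; _∧_; not; if_then_else_; T)
import Data.Bool.Properties as BP
open import Data.Fin using (Fin; toℕ; zero; suc; fromℕ<)
import Data.Fin.Properties as FP
open import Data.Fin.Subset using (Subset; ∣_∣)
import Data.Fin.Subset.Properties as SP
open import Data.Vec using (lookup; []; _∷_; tabulate)
open import Data.Vec.Properties using (lookup∘tabulate)
open import Data.List using (List; []; _∷_; length; map; allFin)
import Data.List.Properties as LP
open import Data.List.Membership.Propositional using (_∈_)
open import Data.List.Relation.Unary.Any using (here; there)
open import Data.List.Relation.Unary.All using (All; []; _∷_)
import Data.List.Relation.Unary.All as All
open import Data.Product using (Σ; ∃; _×_; _,_; proj₁; proj₂)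
open import Data.Sum using (_⊎_; inj₁; inj₂)
open import Data.Empty using (⊥-elim)
open import Function.Bundles using (Equivalence)
open import Relation.Nullary using (Dec; yes; no; ¬_)
open import Relation.Nullary.Decidable using (_×-dec_; _→-dec_)
open import Relation.Binary.PropositionalEquality
open import Relation.Binary.Definitions using (tri<; tri≈; tri>)
open import Algebra.Properties.CommutativeSemigroup +-commutativeSemigroup using (interchange)
open import Data.Nat.Tactic.RingSolver using (solve-∀)

ind : Bool → ℕ
ind b = if b then 1 else 0

∑ : (n : ℕ) → (Fin n → ℕ) → ℕ
∑ zero    f = 0
∑ (suc n) f = f zero + ∑ n (λ i → f (suc i))

sum-allFin : ∀ n (f : Fin n → ℕ) → sum (map f (allFin n)) ≡ ∑ n f
sum-allFin n f = trans (cong sum (LP.map-tabulate (λ i → i) f)) (sum-tabulate n f)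
  where
  sum-tabulate : ∀ n (f : Fin n → ℕ) → sum (Data.List.tabulate f) ≡ ∑ n f
  sum-tabulate zero    f = refl
  sum-tabulate (suc n) f = cong (f zero +_) (sum-tabulate n (λ i → f (suc i)))

∑-cong : ∀ n {f g : Fin n → ℕ} → (∀ i → f i ≡ g i) → ∑ n f ≡ ∑ n g
∑-cong zero    e = refl
∑-cong (suc n) e = cong₂ _+_ (e zero) (∑-cong n (λ i → e (suc i)))

∑-mono : ∀ n {f g : Fin n → ℕ} → (∀ i → f i ≤ g i) → ∑ n f ≤ ∑ n g
∑-mono zero    e = z≤n
∑-mono (suc n) e = +-mono-≤ (e zero) (∑-mono n (λ i → e (suc i)))

∑-zero : ∀ n {f : Fin n → ℕ} → (∀ i → f i ≡ 0) → ∑ n f ≡ 0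
∑-zero zero    e = refl
∑-zero (suc n) e = cong₂ _+_ (e zero) (∑-zero n (λ i → e (suc i)))

∑-+ : ∀ n (f g : Fin n → ℕ) → ∑ n (λ i → f i + g i) ≡ ∑ n f + ∑ n g
∑-+ zero    f g = refl
∑-+ (suc n) f g = trans (cong (f zero + g zero +_) (∑-+ n (λ i → f (suc i)) (λ i → g (suc i))))
                        (interchange (f zero) (g zero) _ _)

∑-const : ∀ n c → ∑ n (λ _ → c) ≡ n * c
∑-const zero    c = refl
∑-const (suc n) c = cong (c +_) (∑-const n c)

∑-scale : ∀ n c (f : Fin n → ℕ) → ∑ n (λ i → c * f i) ≡ c * ∑ n f
∑-scale zero    c f = sym (*-zeroʳ c)
∑-scale (suc n) c f = trans (cong (c * f zero +_) (∑-scale n c (λ i → f (suc i))))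
                            (sym (*-distribˡ-+ c (f zero) _))

∑-swap : ∀ n m (f : Fin n → Fin m → ℕ) → ∑ n (λ i → ∑ m (f i)) ≡ ∑ m (λ j → ∑ n (λ i → f i j))
∑-swap zero    m f = sym (∑-zero m (λ _ → refl))
∑-swap (suc n) m f = trans (cong (∑ m (f zero) +_) (∑-swap n m (λ i → f (suc i))))
                           (sym (∑-+ m (f zero) (λ j → ∑ n (λ i → f (suc i) j))))

∑-pick : ∀ n (x : Fin n) {h g : Fin n → ℕ} (c : ℕ) →
  (∀ i → i ≢ x → h i ≤ g i) → h x + c ≤ g x → ∑ n h + c ≤ ∑ n g
∑-pick (suc n) zero {h} {g} c rest hx = begin
    h zero + ∑ n (λ i → h (suc i)) + c   ≡⟨ +-assoc (h zero) _ c ⟩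
    h zero + (∑ n (λ i → h (suc i)) + c) ≡⟨ cong (h zero +_) (+-comm _ c) ⟩
    h zero + (c + ∑ n (λ i → h (suc i))) ≡⟨ sym (+-assoc (h zero) c _) ⟩
    h zero + c + ∑ n (λ i → h (suc i))   ≤⟨ +-mono-≤ hx (∑-mono n (λ i → rest (suc i) (λ ()))) ⟩
    g zero + ∑ n (λ i → g (suc i))       ∎
  where open ≤-Reasoning
∑-pick (suc n) (suc x) {h} {g} c rest hx = begin
    h zero + ∑ n (λ i → h (suc i)) + c   ≡⟨ +-assoc (h zero) _ c ⟩
    h zero + (∑ n (λ i → h (suc i)) + c) ≤⟨ +-mono-≤ (rest zero (λ ())) (∑-pick n x c rest' hx) ⟩
    g zero + ∑ n (λ i → g (suc i))       ∎
  where
  open ≤-Reasoning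
  rest' : ∀ i → i ≢ x → h (suc i) ≤ g (suc i)
  rest' i i≢x = rest (suc i) (λ e → i≢x (FP.suc-injective e))

∑-point : ∀ n (x : Fin n) (f : Fin n → ℕ) → f x ≤ ∑ n f
∑-point n x f = subst (_≤ ∑ n f) (cong (_+ f x) (∑-zero n {λ _ → 0} (λ _ → refl)))
  (∑-pick n x {λ _ → 0} {f} (f x) (λ _ _ → z≤n) ≤-refl)

∑-two : ∀ n (a b : Fin n) (f : Fin n → ℕ) → a ≢ b → f a + f b ≤ ∑ n f
∑-two n a b f a≢b = begin
    f a + f b       ≤⟨ +-monoʳ-≤ (f a) (subst (_≤ ∑ n onlyB) onlyB-b (∑-point n b onlyB)) ⟩
    f a + ∑ n onlyB ≡⟨ +-comm (f a) _ ⟩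
    ∑ n onlyB + f a ≤⟨ ∑-pick n a {onlyB} {f} (f a) below (≤-reflexive (cong (_+ f a) onlyB-a)) ⟩
    ∑ n f           ∎
  where
  open ≤-Reasoning
  onlyB : Fin n → ℕ
  onlyB i with i FP.≟ b
  ... | yes _ = f b
  ... | no  _ = 0
  onlyB-b : onlyB b ≡ f b
  onlyB-b with b FP.≟ b
  ... | yes _   = refl
  ... | no  b≢b = ⊥-elim (b≢b refl)
  onlyB-a : onlyB a ≡ 0
  onlyB-a with a FP.≟ b
  ... | yes a≡b = ⊥-elim (a≢b a≡b)
  ... | no  _   = refl
  below : ∀ i → i ≢ a → onlyB i ≤ f i
  below i _ with i FP.≟ b
  ... | yes refl = ≤-refl
  ... | no  _    = z≤n

∑-atMostOne : ∀ n (P : Fin n → Bool) → (∀ i j → P i ≡ true → P j ≡ true → i ≡ j) →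
  ∑ n (λ i → ind (P i)) ≤ 1
∑-atMostOne zero    P unique = z≤n
∑-atMostOne (suc n) P unique with P zero in P0
... | true  = ≤-reflexive (cong suc (∑-zero n others))
  where
  others : ∀ i → ind (P (suc i)) ≡ 0
  others i with P (suc i) in Pi
  ... | true  with () ← unique zero (suc i) P0 Pi
  ... | false = refl
... | false = ∑-atMostOne n (λ i → P (suc i)) (λ i j p q → FP.suc-injective (unique (suc i) (suc j) p q))

∑-complement : ∀ n (d : Fin n → Bool) → ∑ n (λ i → ind (not (d i))) + ∑ n (λ i → ind (d i)) ≡ n
∑-complement n d = begin
    ∑ n (λ i → ind (not (d i))) + ∑ n (λ i → ind (d i)) ≡⟨ ∑-+ n _ _ ⟨
    ∑ n (λ i → ind (not (d i)) + ind (d i))             ≡⟨ ∑-cong n (λ i → one (d i)) ⟩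
    ∑ n (λ _ → 1)                                       ≡⟨ ∑-const n 1 ⟩
    n * 1                                               ≡⟨ *-identityʳ n ⟩
    n                                                   ∎
  where
  open ≡-Reasoning
  one : ∀ b → ind (not b) + ind b ≡ 1
  one true  = refl
  one false = refl

∑-below : ∀ n c → c ≤ n → ∑ n (λ i → ind (toℕ i <ᵇ c)) ≡ c
∑-below zero    zero    z≤n       = refl
∑-below (suc n) zero    _         = ∑-zero (suc n) (λ _ → refl)
∑-below (suc n) (suc c) (s≤s c≤n) = cong suc (∑-below n c c≤n)

missing : ∀ n (d : Fin n → Bool) → ∑ n (λ i → ind (d i)) < n → ∃ λ x → d x ≡ false
missing (suc n) d lt with d zero in d0
... | false = zero , d0
... | true  with x , dx ← missing n (λ i → d (suc i)) (s≤s⁻¹ lt) = suc x , dx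

size-∑ : ∀ {n} (D : Subset n) → ∣ D ∣ ≡ ∑ n (λ i → ind (lookup D i))
size-∑ []          = refl
size-∑ (true ∷ D)  = cong suc (size-∑ D)
size-∑ (false ∷ D) = size-∑ D

size-tabulate : ∀ n (f : Fin n → Bool) → ∣ tabulate f ∣ ≡ ∑ n (λ i → ind (f i))
size-tabulate n f = trans (size-∑ (tabulate f)) (∑-cong n (λ i → cong ind (lookup∘tabulate f i)))

T⇒≡ : ∀ {b} → T b → b ≡ true
T⇒≡ = Equivalence.to BP.T-≡

≡⇒T : ∀ {b} → b ≡ true → T b
≡⇒T = Equivalence.from BP.T-≡

≡ᵇ-true : ∀ {m n} → (m ≡ᵇ n) ≡ true → m ≡ n
≡ᵇ-true {m} {n} e = ≡ᵇ⇒≡ m n (≡⇒T e)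

≡ᵇ-refl : ∀ m → (m ≡ᵇ m) ≡ true
≡ᵇ-refl zero    = refl
≡ᵇ-refl (suc m) = ≡ᵇ-refl m

≡ᵇ-false : ∀ {m n} → m ≢ n → (m ≡ᵇ n) ≡ false
≡ᵇ-false {m} {n} m≢n with m ≡ᵇ n in e
... | true  = ⊥-elim (m≢n (≡ᵇ-true e))
... | false = refl

not-false : ∀ {b} → not b ≡ false → b ≡ true
not-false {true} _ = refl

∨-true : ∀ {a b} → (a ∨ b) ≡ true → a ≡ true ⊎ b ≡ true
∨-true {true}  _ = inj₁ refl
∨-true {false} e = inj₂ e

∧-true : ∀ {a b} → (a ∧ b) ≡ true → a ≡ true × b ≡ true
∧-true {true} e = refl , e

ind-∧ : ∀ a b → ind (a ∧ b) ≤ ind a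
ind-∧ true  true  = ≤-refl
ind-∧ true  false = z≤n
ind-∧ false b     = z≤n

ind-∨ : ∀ a b → ind (a ∨ b) ≤ ind a + ind b
ind-∨ true  b = s≤s z≤n
ind-∨ false b = ≤-refl

ind-true : ∀ {a b} → a ≡ true → b ≡ true → ind (a ∧ b) ≡ 1
ind-true refl refl = refl

follows : ℕ → ℕ → ℕ → Bool
follows n u v = (suc u ≡ᵇ v) ∨ ((suc u ≡ᵇ n) ∧ (v ≡ᵇ 0))

-- 'cycle n i j' is by definition 'cycleℕ n (toℕ i) (toℕ j)'.
cycleℕ : ℕ → ℕ → ℕ → Bool
cycleℕ n u v = follows n u v ∨ follows n v u

next prev : ℕ → ℕ → ℕ
next n u = if suc u ≡ᵇ n then 0 else suc u
prev n v = if v ≡ᵇ 0 then pred n else pred v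

follows-next : ∀ n u v → v < n → follows n u v ≡ true → v ≡ next n u
follows-next n u v v<n e with suc u ≡ᵇ n in closing | ∨-true {suc u ≡ᵇ v} e
... | true  | inj₁ u+1≡v = ⊥-elim (<-irrefl (trans (sym (≡ᵇ-true {suc u} u+1≡v)) (≡ᵇ-true closing)) v<n)
... | true  | inj₂ v≡0   = ≡ᵇ-true v≡0
... | false | inj₁ u+1≡v = sym (≡ᵇ-true u+1≡v)

follows-prev : ∀ n u v → follows n u v ≡ true → u ≡ prev n v
follows-prev n u v e with suc u ≡ᵇ v in step | ∨-true {suc u ≡ᵇ v} e
... | true  | _ with refl ← ≡ᵇ-true {suc u} {v} step = refl
... | false | inj₂ wrap with closing , v≡0 ← ∧-true {suc u ≡ᵇ n} wrap
                        with refl ← ≡ᵇ-true {v} {0} v≡0 | refl ← ≡ᵇ-true {suc u} {n} closing = refl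

cycle-degree : ∀ n (x : Fin n) → ∑ n (λ j → ind (cycle n x j)) ≤ 2
cycle-degree n x = begin
    ∑ n (λ j → ind (cycle n x j))                                  ≤⟨ ∑-mono n (λ j → ind-∨ (isSucc n x j) _) ⟩
    ∑ n (λ j → ind (isSucc n x j) + ind (isSucc n j x))            ≡⟨ ∑-+ n _ _ ⟩
    ∑ n (λ j → ind (isSucc n x j)) + ∑ n (λ j → ind (isSucc n j x)) ≤⟨ +-mono-≤ successor predecessor ⟩
    2                                                               ∎
  where
  open ≤-Reasoning
  successor : ∑ n (λ j → ind (isSucc n x j)) ≤ 1
  successor = ∑-atMostOne n _ (λ i j p q → FP.toℕ-injective
    (trans (follows-next n _ _ (FP.toℕ<n i) p) (sym (follows-next n _ _ (FP.toℕ<n j) q))))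
  predecessor : ∑ n (λ j → ind (isSucc n j x)) ≤ 1
  predecessor = ∑-atMostOne n _ (λ i j p q → FP.toℕ-injective
    (trans (follows-prev n _ (toℕ x) p) (sym (follows-prev n _ (toℕ x) q))))

cycle-next : ∀ n u → cycleℕ n u (suc u) ≡ true
cycle-next n u rewrite ≡ᵇ-refl u = refl

cycle-prev : ∀ n u → cycleℕ n (suc u) u ≡ true
cycle-prev n u rewrite ≡ᵇ-refl u = BP.∨-zeroʳ _

cycle-close : ∀ n u → suc u ≡ n → cycleℕ n u 0 ≡ true
cycle-close n u refl rewrite ≡ᵇ-refl u = refl

NonEdge : ℕ → ℕ × ℕ → Set
NonEdge n (a , b) = a < b × suc a ≢ b × (a ≡ 0 → suc b ≢ n)

nonEdge-false : ∀ n {a b} → NonEdge n (a , b) → cycleℕ n a b ≡ false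
nonEdge-false n {a} {b} (a<b , gap , notClosing)
  rewrite ≡ᵇ-false gap | ≡ᵇ-false {b} {0} (λ { refl → n≮0 a<b })
        | ≡ᵇ-false {suc b} {a} (λ b+1≡a → <-asym a<b (≤-reflexive b+1≡a))
  = closing a refl
  where
  closing : ∀ a' → a' ≡ a → ((suc a ≡ᵇ n) ∧ false) ∨ ((suc b ≡ᵇ n) ∧ (a' ≡ᵇ 0)) ≡ false
  closing zero    a≡0 rewrite ≡ᵇ-false (notClosing (sym a≡0)) | BP.∧-zeroʳ (suc a ≡ᵇ n) = refl
  closing (suc _) _   rewrite BP.∧-zeroʳ (suc a ≡ᵇ n) | BP.∧-zeroʳ (suc b ≡ᵇ n) = refl

∑² : (n : ℕ) → (Fin n → Fin n → ℕ) → ℕ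
∑² n f = ∑ n (λ i → ∑ n (f i))

∑²-mono : ∀ n {f g : Fin n → Fin n → ℕ} → (∀ i j → f i j ≤ g i j) → ∑² n f ≤ ∑² n g
∑²-mono n le = ∑-mono n (λ i → ∑-mono n (le i))

∑²-+ : ∀ n (f g : Fin n → Fin n → ℕ) → ∑² n (λ i j → f i j + g i j) ≡ ∑² n f + ∑² n g
∑²-+ n f g = trans (∑-cong n (λ i → ∑-+ n (f i) (g i))) (∑-+ n _ _)

arcs : ∀ {n} → Graph n → ℕ
arcs {n} R = ∑² n (λ i j → ind (R i j))

_≺_ : ∀ {n} → Fin n → Fin n → Bool
i ≺ j = suc (toℕ i) ≤ᵇ toℕ j

≺-trichotomy : ∀ {n} (i j : Fin n) → (i ≺ j) ≡ true ⊎ (j ≺ i) ≡ true ⊎ i ≡ j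
≺-trichotomy i j with <-cmp (toℕ i) (toℕ j)
... | tri< i<j _ _ = inj₁ (T⇒≡ (≤⇒≤ᵇ i<j))
... | tri≈ _ i≡j _ = inj₂ (inj₂ (FP.toℕ-injective i≡j))
... | tri> _ _ j<i = inj₂ (inj₁ (T⇒≡ (≤⇒≤ᵇ j<i)))

edgeCount-arcs : ∀ {n} (B : Graph n) → edgeCount B ≡ arcs (λ i j → (i ≺ j) ∧ B i j)
edgeCount-arcs {n} B = trans (sum-allFin n _) (∑-cong n (λ i → sum-allFin n _))

-- An asymmetric relation R inside a symmetric graph B has at most edgeCount B pairs:
-- of the two orientations of an edge of B at most one lies in R.
asymmetric-arcs : ∀ {n} (B R : Graph n) → (∀ i j → B i j ≡ B j i) →
  (∀ i j → R i j ≡ true → B i j ≡ true) → (∀ i j → R i j ≡ true → R j i ≡ false) →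
  arcs R ≤ edgeCount B
asymmetric-arcs {n} B R symmetric R⊆B asym = begin
    arcs R
      ≤⟨ ∑²-mono n orient ⟩
    ∑² n (λ i j → ind ((i ≺ j) ∧ R i j) + ind ((j ≺ i) ∧ R i j))
      ≡⟨ ∑²-+ n _ _ ⟩
    arcs (λ i j → (i ≺ j) ∧ R i j) + ∑² n (λ i j → ind ((j ≺ i) ∧ R i j))
      ≡⟨ cong (arcs (λ i j → (i ≺ j) ∧ R i j) +_) (∑-swap n n _) ⟩
    arcs (λ i j → (i ≺ j) ∧ R i j) + arcs (λ i j → (i ≺ j) ∧ R j i)
      ≡⟨ ∑²-+ n _ _ ⟨
    ∑² n (λ i j → ind ((i ≺ j) ∧ R i j) + ind ((i ≺ j) ∧ R j i))
      ≤⟨ ∑²-mono n (λ i j → one-orientation (i ≺ j) (R⊆B i j) (λ r → trans (symmetric i j) (R⊆B j i r)) (asym i j)) ⟩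
    arcs (λ i j → (i ≺ j) ∧ B i j)
      ≡⟨ edgeCount-arcs B ⟨
    edgeCount B ∎
  where
  open ≤-Reasoning
  -- Each pair of R has an orientation (R is irreflexive, being asymmetric).
  orient : ∀ i j → ind (R i j) ≤ ind ((i ≺ j) ∧ R i j) + ind ((j ≺ i) ∧ R i j)
  orient i j with ≺-trichotomy i j
  ... | inj₁ i≺j        rewrite i≺j = m≤m+n _ _
  ... | inj₂ (inj₁ j≺i) rewrite j≺i = m≤n+m _ _
  ... | inj₂ (inj₂ refl) with R i i in Rii
  ...   | true  with () ← trans (sym Rii) (asym i i Rii)
  ...   | false = z≤n
  one-orientation : ∀ l {r r' b} → (r ≡ true → b ≡ true) → (r' ≡ true → b ≡ true) →
    (r ≡ true → r' ≡ false) → ind (l ∧ r) + ind (l ∧ r') ≤ ind (l ∧ b)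
  one-orientation false _ _ _ = z≤n
  one-orientation true {true}  {r'}   rb _   r→¬r' rewrite rb refl | r→¬r' refl = ≤-refl
  one-orientation true {false} {true} _  r'b _     rewrite r'b refl = ≤-refl
  one-orientation true {false} {false} _ _ _ = z≤n

degree≤edgeCount : ∀ {n} (B : Graph n) → IsSimple B → (x : Fin n) → ∑ n (λ j → ind (B x j)) ≤ edgeCount B
degree≤edgeCount {n} B (symmetric , loopless) x = begin
    ∑ n (λ j → ind (B x j))  ≡⟨ ∑-cong n (λ j → cong (λ b → ind (b ∧ B x j)) (sym (≡ᵇ-refl (toℕ x)))) ⟩
    ∑ n (λ j → ind (atX x j)) ≤⟨ ∑-point n x (λ i → ∑ n (λ j → ind (atX i j))) ⟩
    arcs atX                  ≤⟨ asymmetric-arcs B atX symmetric (λ i j e → proj₂ (∧-true e)) asym ⟩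
    edgeCount B               ∎
  where
  open ≤-Reasoning
  -- The edges of B leaving x, as an asymmetric relation (B is loopless).
  atX : Graph n
  atX i j = (toℕ i ≡ᵇ toℕ x) ∧ B i j
  asym : ∀ i j → atX i j ≡ true → atX j i ≡ false
  asym i j e with toℕ j ≡ᵇ toℕ x in j≡x
  ... | false = refl
  ... | true with i≡x , Bij ← ∧-true {toℕ i ≡ᵇ toℕ x} e
             with refl ← FP.toℕ-injective (≡ᵇ-true {toℕ i} {toℕ x} i≡x) | refl ← FP.toℕ-injective (≡ᵇ-true {toℕ j} {toℕ x} j≡x)
             with () ← trans (sym Bij) (loopless i)

augmented-degree : ∀ {n} (B : Graph n) → IsSimple B → (D : Subset n) (x : Fin n) →
  degIn (cycle n +E B) D x ≤ 2 + edgeCount B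
augmented-degree {n} B simple D x = begin
    degIn (cycle n +E B) D x                                 ≡⟨ sum-allFin n _ ⟩
    ∑ n (λ j → ind ((cycle n x j ∨ B x j) ∧ lookup D j))     ≤⟨ ∑-mono n (λ j → ≤-trans (ind-∧ _ (lookup D j)) (ind-∨ (cycle n x j) _)) ⟩
    ∑ n (λ j → ind (cycle n x j) + ind (B x j))              ≡⟨ ∑-+ n _ _ ⟩
    ∑ n (λ j → ind (cycle n x j)) + ∑ n (λ j → ind (B x j)) ≤⟨ +-mono-≤ (cycle-degree n x) (degree≤edgeCount B simple x) ⟩
    2 + edgeCount B                                          ∎
  where open ≤-Reasoning

pairEdge : ℕ → ℕ → ℕ → ℕ → Bool
pairEdge a b u v = ((u ≡ᵇ a) ∧ (v ≡ᵇ b)) ∨ ((u ≡ᵇ b) ∧ (v ≡ᵇ a))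

edgesℕ : List (ℕ × ℕ) → ℕ → ℕ → Bool
edgesℕ []             u v = false
edgesℕ ((a , b) ∷ ps) u v = pairEdge a b u v ∨ edgesℕ ps u v

edges : ∀ {n} → List (ℕ × ℕ) → Graph n
edges ps i j = edgesℕ ps (toℕ i) (toℕ j)

edgesℕ-sym : ∀ ps u v → edgesℕ ps u v ≡ edgesℕ ps v u
edgesℕ-sym []             u v = refl
edgesℕ-sym ((a , b) ∷ ps) u v = cong₂ _∨_ (swap (u ≡ᵇ a) (v ≡ᵇ b) (u ≡ᵇ b) (v ≡ᵇ a)) (edgesℕ-sym ps u v)
  where
  swap : ∀ x y z w → ((x ∧ y) ∨ (z ∧ w)) ≡ ((w ∧ z) ∨ (y ∧ x))
  swap x y z w rewrite BP.∧-comm x y | BP.∧-comm z w = BP.∨-comm (y ∧ x) (w ∧ z)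

edgesℕ-listed : ∀ ps u v → edgesℕ ps u v ≡ true → ∃ λ q → q ∈ ps × (q ≡ (u , v) ⊎ q ≡ (v , u))
edgesℕ-listed ((a , b) ∷ ps) u v e with ∨-true {pairEdge a b u v} e
... | inj₂ rest with q , q∈ps , q≡ ← edgesℕ-listed ps u v rest = q , there q∈ps , q≡
... | inj₁ hit with ∨-true {(u ≡ᵇ a) ∧ (v ≡ᵇ b)} hit
...   | inj₁ uv with u≡a , v≡b ← ∧-true {u ≡ᵇ a} uv
               = (a , b) , here refl , inj₁ (sym (cong₂ _,_ (≡ᵇ-true u≡a) (≡ᵇ-true v≡b)))
...   | inj₂ vu with u≡b , v≡a ← ∧-true {u ≡ᵇ b} vu
               = (a , b) , here refl , inj₂ (sym (cong₂ _,_ (≡ᵇ-true v≡a) (≡ᵇ-true u≡b)))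

edgesℕ-∈ : ∀ {a b} ps → (a , b) ∈ ps → edgesℕ ps a b ≡ true
edgesℕ-∈ {a} {b} ((a , b) ∷ ps) (here refl) rewrite ≡ᵇ-refl a | ≡ᵇ-refl b = refl
edgesℕ-∈ (q ∷ ps) (there a,b∈ps) rewrite edgesℕ-∈ ps a,b∈ps = BP.∨-zeroʳ _

edges-complement : ∀ n ps → All (NonEdge n) ps → IsComplEdgeSet (cycle n) (edges ps)
edges-complement n ps nonEdges =
  ((λ i j → edgesℕ-sym ps (toℕ i) (toℕ j)) , (λ i → loopless (toℕ i))) , (λ i j → nonCycle (toℕ i) (toℕ j))
  where
  loopless : ∀ u → edgesℕ ps u u ≡ false
  loopless u with edgesℕ ps u u in e
  ... | false = refl
  ... | true with q , q∈ps , q≡ ← edgesℕ-listed ps u u e = ⊥-elim (noLoop q≡ (All.lookup nonEdges q∈ps))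
    where
    noLoop : ∀ {q} → q ≡ (u , u) ⊎ q ≡ (u , u) → ¬ NonEdge n q
    noLoop (inj₁ refl) (u<u , _) = <-irrefl refl u<u
    noLoop (inj₂ refl) (u<u , _) = <-irrefl refl u<u
  nonCycle : ∀ u v → edgesℕ ps u v ≡ true → cycleℕ n u v ≡ false
  nonCycle u v e with edgesℕ-listed ps u v e
  ... | _ , q∈ps , inj₁ refl = nonEdge-false n (All.lookup nonEdges q∈ps)
  ... | _ , q∈ps , inj₂ refl = trans (BP.∨-comm (follows n u v) _) (nonEdge-false n (All.lookup nonEdges q∈ps))

∑-label : ∀ n a → ∑ n (λ i → ind (toℕ i ≡ᵇ a)) ≤ 1
∑-label n a = ∑-atMostOne n _ (λ i j p q → FP.toℕ-injective (trans (≡ᵇ-true p) (sym (≡ᵇ-true q))))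

pair-count : ∀ n {a b} → a < b → arcs {n} (λ i j → (i ≺ j) ∧ pairEdge a b (toℕ i) (toℕ j)) ≤ 1
pair-count n {a} {b} a<b = begin
    arcs {n} (λ i j → (i ≺ j) ∧ pairEdge a b (toℕ i) (toℕ j)) ≤⟨ ∑²-mono n oriented ⟩
    ∑² n (λ i j → ind ((toℕ i ≡ᵇ a) ∧ (toℕ j ≡ᵇ b)))          ≤⟨ ∑-mono n row ⟩
    ∑ n (λ i → ind (toℕ i ≡ᵇ a))                              ≤⟨ ∑-label n a ⟩
    1                                                         ∎
  where
  open ≤-Reasoning
  -- Only the orientation (a , b) is increasing.
  oriented : ∀ i j → ind ((i ≺ j) ∧ pairEdge a b (toℕ i) (toℕ j)) ≤ ind ((toℕ i ≡ᵇ a) ∧ (toℕ j ≡ᵇ b))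
  oriented i j with i ≺ j in i≺j | pairEdge a b (toℕ i) (toℕ j) in e
  ... | false | _     = z≤n
  ... | true  | false = z≤n
  ... | true  | true with ∨-true {(toℕ i ≡ᵇ a) ∧ (toℕ j ≡ᵇ b)} e
  ...   | inj₁ hit rewrite hit = ≤-refl
  ...   | inj₂ rev with i≡b , j≡a ← ∧-true {toℕ i ≡ᵇ b} rev =
              ⊥-elim (<-asym a<b (subst₂ _<_ (≡ᵇ-true {toℕ i} i≡b) (≡ᵇ-true {toℕ j} j≡a) (≤ᵇ⇒≤ (suc (toℕ i)) (toℕ j) (≡⇒T i≺j))))
  row : ∀ i → ∑ n (λ j → ind ((toℕ i ≡ᵇ a) ∧ (toℕ j ≡ᵇ b))) ≤ ind (toℕ i ≡ᵇ a)
  row i with toℕ i ≡ᵇ a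
  ... | true  = ∑-label n b
  ... | false = ≤-reflexive (∑-zero n (λ _ → refl))

edges-count : ∀ n ps → All (λ q → proj₁ q < proj₂ q) ps → edgeCount {n} (edges ps) ≤ length ps
edges-count n [] [] = ≤-reflexive (trans (edgeCount-arcs {n} (edges [])) (∑-zero n (λ i → ∑-zero n (λ j → cong ind (BP.∧-zeroʳ (i ≺ j))))))
edges-count n ((a , b) ∷ ps) (a<b ∷ ordered) = begin
    edgeCount {n} (edges ((a , b) ∷ ps))
      ≡⟨ edgeCount-arcs {n} (edges ((a , b) ∷ ps)) ⟩
    arcs {n} (λ i j → (i ≺ j) ∧ (pairEdge a b (toℕ i) (toℕ j) ∨ edgesℕ ps (toℕ i) (toℕ j)))
      ≤⟨ ∑²-mono n (λ i j → distrib (i ≺ j) (pairEdge a b (toℕ i) (toℕ j)) _) ⟩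
    ∑² n (λ i j → ind ((i ≺ j) ∧ pairEdge a b (toℕ i) (toℕ j)) + ind ((i ≺ j) ∧ edgesℕ ps (toℕ i) (toℕ j)))
      ≡⟨ ∑²-+ n _ _ ⟩
    arcs {n} (λ i j → (i ≺ j) ∧ pairEdge a b (toℕ i) (toℕ j)) + arcs {n} (λ i j → (i ≺ j) ∧ edges ps i j)
      ≤⟨ +-mono-≤ (pair-count n a<b) (≤-trans (≤-reflexive (sym (edgeCount-arcs {n} (edges ps)))) (edges-count n ps ordered)) ⟩
    suc (length ps) ∎
  where
  open ≤-Reasoning
  distrib : ∀ l x y → ind (l ∧ (x ∨ y)) ≤ ind (l ∧ x) + ind (l ∧ y)
  distrib false x y = z≤n
  distrib true  x y = ind-∨ x y

isPDom? : ∀ {n} p (H : Graph n) (D : Subset n) → Dec (IsPDom p H D)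
isPDom? p H D = FP.all? (λ x → (lookup D x BP.≟ false) →-dec (p ≤? degIn H D x))

-- A graph with a p-dominating set D has a domination number γ_p ≤ |D|:
-- repeatedly replace D by a smaller p-dominating set while there is one.
γ-exists : ∀ {n} p (H : Graph n) (D : Subset n) → IsPDom p H D → ∃ λ k → IsGammaP p H k × k ≤ ∣ D ∣
γ-exists p H D = shrink ∣ D ∣ D ≤-refl
  where
  shrink : ∀ fuel D → ∣ D ∣ ≤ fuel → IsPDom p H D → ∃ λ k → IsGammaP p H k × k ≤ ∣ D ∣
  shrink fuel D bound dom with SP.anySubset? (λ E → isPDom? p H E ×-dec (∣ E ∣ <? ∣ D ∣))
  ... | no noSmaller = ∣ D ∣ , ((D , dom , refl) , (λ E domE → ≮⇒≥ (λ E<D → noSmaller (E , domE , E<D)))) , ≤-refl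
  ... | yes (E , domE , E<D) with fuel
  ...   | zero   = ⊥-elim (n≮0 (≤-trans E<D bound))
  ...   | suc fuel' with k , γk , k≤E ← shrink fuel' E (s≤s⁻¹ (≤-trans E<D bound)) domE
                    = k , γk , ≤-trans k≤E (<⇒≤ E<D)

γ-unique : ∀ {n} p (H : Graph n) {k k'} → IsGammaP p H k → IsGammaP p H k' → k ≡ k'
γ-unique p H ((D , domD , refl) , minD) ((E , domE , refl) , minE) = ≤-antisym (minD E domE) (minE D domD)

-- The whole vertex set is p-dominating, so γ_p ≤ n.
γ≤n : ∀ {n} p (H : Graph n) {k} → IsGammaP p H k → k ≤ n
γ≤n {n} p H (_ , minimal) = subst (_ ≤_) everything-size (minimal everything everything-dom)
  where
  everything : Subset n
  everything = tabulate (λ _ → true)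
  everything-size : ∣ everything ∣ ≡ n
  everything-size = trans (size-tabulate n _) (trans (∑-const n 1) (*-identityʳ n))
  everything-dom : IsPDom p H everything
  everything-dom x x∉V with () ← trans (sym (lookup∘tabulate (λ _ → true) x)) x∉V

reinforces-by : ∀ {n} p (G B : Graph n) {k} (D : Subset n) → IsGammaP p G k →
  IsPDom p (G +E B) D → ∣ D ∣ < k → Reinforces p G B
reinforces-by p G B D γk domD D<k with k' , γk' , k'≤D ← γ-exists p (G +E B) D domD =
  _ , k' , γk , γk' , <-≤-trans (s≤s k'≤D) D<k

reinforcement-number : ∀ {n} p (G : Graph n) r → (∃ λ g → IsGammaP p G g × p < g) →
  (Σ (Graph n) λ B → IsComplEdgeSet G B × Reinforces p G B × edgeCount B ≤ r) →
  (∀ B → IsComplEdgeSet G B → Reinforces p G B → r ≤ edgeCount B) →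
  IsReinforcementNumber p G r
reinforcement-number p G r (g , γg , p<g) (B , complB , reinforcesB , B≤r) lower =
  (λ k γk k≤p → ⊥-elim (<⇒≱ p<g (subst (_≤ p) (γ-unique p G γk γg) k≤p))) ,
  (λ _ _ _ → (B , complB , reinforcesB , ≤-antisym B≤r (lower B complB reinforcesB)) , lower)

cycle-degIn : ∀ n (D : Subset n) x → degIn (cycle n) D x ≤ 2
cycle-degIn n D x = begin
    degIn (cycle n) D x                          ≡⟨ sum-allFin n _ ⟩
    ∑ n (λ j → ind (cycle n x j ∧ lookup D j))   ≤⟨ ∑-mono n (λ j → ind-∧ (cycle n x j) (lookup D j)) ⟩
    ∑ n (λ j → ind (cycle n x j))                ≤⟨ cycle-degree n x ⟩
    2                                            ∎
  where open ≤-Reasoning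

-- For p ≥ 3 no vertex outside D can have p neighbours in D, so only V p-dominates C_n: γ_p(C_n) = n.
γ-cycle-large-p : ∀ n p → 3 ≤ p → ∀ {k} → IsGammaP p (cycle n) k → k ≡ n
γ-cycle-large-p n p 3≤p γk@((D , domD , refl) , _) = ≤-antisym (γ≤n p (cycle n) γk) (≮⇒≥ D-is-small)
  where
  D-is-small : ¬ ∣ D ∣ < n
  D-is-small D<n with x , x∉D ← missing n (lookup D) (subst (_< n) (size-∑ D) D<n) =
    <⇒≱ 3≤p (≤-trans (domD x x∉D) (cycle-degIn n D x))

-- If B reinforces C_n, the smaller p-dominating set of C_n + B misses some vertex,
-- which then has p ≤ 2 + |B| neighbours.
reinforcement-lower : ∀ n p B → IsComplEdgeSet (cycle n) B → Reinforces p (cycle n) B → p ∸ 2 ≤ edgeCount B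
reinforcement-lower n p B (simple , _) (k , _ , γk , ((D , domD , refl) , _) , D<k)
  with x , x∉D ← missing n (lookup D) (subst (_< n) (size-∑ D) (<-≤-trans D<k (γ≤n p (cycle n) γk))) = begin
    p ∸ 2                    ≤⟨ ∸-monoˡ-≤ 2 (≤-trans (domD x x∉D) (augmented-degree B simple D x)) ⟩
    2 + edgeCount B ∸ 2      ≡⟨ m+n∸m≡n 2 _ ⟩
    edgeCount B              ∎
  where open ≤-Reasoning

labelSet : ∀ {n} → (ℕ → Bool) → Subset n
labelSet d = tabulate (λ i → d (toℕ i))

labelSet-∉ : ∀ {n} (d : ℕ → Bool) (x : Fin n) → lookup (labelSet d) x ≡ false → d (toℕ x) ≡ false
labelSet-∉ d x x∉D = trans (sym (lookup∘tabulate (λ i → d (toℕ i)) x)) x∉D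

labelSet-size : ∀ n (d : ℕ → Bool) → ∣ labelSet {n} d ∣ ≡ ∑ n (λ i → ind (d (toℕ i)))
labelSet-size n d = size-tabulate n (λ i → d (toℕ i))

degIn-labels : ∀ n (H : ℕ → ℕ → Bool) (d : ℕ → Bool) (x : Fin n) →
  degIn (λ i j → H (toℕ i) (toℕ j)) (labelSet d) x ≡ ∑ n (λ j → ind (H (toℕ x) (toℕ j) ∧ d (toℕ j)))
degIn-labels n H d x = trans (sum-allFin n _)
  (∑-cong n (λ j → cong (λ b → ind (H (toℕ x) (toℕ j) ∧ b)) (lookup∘tabulate (λ i → d (toℕ i)) j)))

∑-initial+1 : ∀ n m (f : Fin n → ℕ) (y : Fin n) → m ≤ n → m ≤ toℕ y →
  (∀ j → toℕ j < m → 1 ≤ f j) → 1 ≤ f y → suc m ≤ ∑ n f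
∑-initial+1 n m f y m≤n m≤y initial 1≤fy =
  subst (_≤ ∑ n f) (trans (cong (_+ 1) (∑-below n m m≤n)) (+-comm m 1))
    (∑-pick n y {λ j → ind (toℕ j <ᵇ m)} {f} 1 (λ j _ → below j) (subst (λ b → ind b + 1 ≤ f y) (sym y-late) 1≤fy))
  where
  below : ∀ j → ind (toℕ j <ᵇ m) ≤ f j
  below j with toℕ j <ᵇ m in j<m
  ... | true  = initial j (<ᵇ⇒< (toℕ j) m (≡⇒T j<m))
  ... | false = z≤n
  y-late : (toℕ y <ᵇ m) ≡ false
  y-late with toℕ y <ᵇ m in y<m
  ... | true  = ⊥-elim (<⇒≱ (<ᵇ⇒< (toℕ y) m (≡⇒T y<m)) m≤y)
  ... | false = refl

∨-introˡ : ∀ {a} b → a ≡ true → (a ∨ b) ≡ true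
∨-introˡ b refl = refl

∨-introʳ : ∀ a {b} → b ≡ true → (a ∨ b) ≡ true
∨-introʳ a refl = BP.∨-zeroʳ a

labelSet-missing : ∀ n (d : ℕ → Bool) {c} → c < n → d c ≡ false → ∣ labelSet {n} d ∣ < n
labelSet-missing n d {c} c<n dc = subst₂ _≤_ (trans (+-comm _ 1) (cong suc (sym (labelSet-size n d))))
  (trans (∑-const n 1) (*-identityʳ n))
  (∑-pick n (fromℕ< c<n) {λ i → ind (d (toℕ i))} {λ _ → 1} 1 (λ i _ → atMost1 (d (toℕ i))) c-absent)
  where
  atMost1 : ∀ b → ind b ≤ 1
  atMost1 true  = ≤-refl
  atMost1 false = z≤n
  c-absent : ind (d (toℕ (fromℕ< c<n))) + 1 ≤ 1
  c-absent rewrite FP.toℕ-fromℕ< c<n | dc = ≤-refl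

star : ℕ → ℕ → List (ℕ × ℕ)
star c zero    = []
star c (suc k) = (suc k , c) ∷ star c k

star-length : ∀ c k → length (star c k) ≡ k
star-length c zero    = refl
star-length c (suc k) = cong suc (star-length c k)

star-nonEdges : ∀ c k → suc (suc k) ≤ c → All (NonEdge (suc c)) (star c k)
star-nonEdges c zero    _ = []
star-nonEdges c (suc k) k+3≤c =
  (≤-trans (n≤1+n _) k+3≤c , (λ { refl → <-irrefl refl k+3≤c }) , (λ ())) ∷ star-nonEdges c k (≤-trans (n≤1+n _) k+3≤c)

star-∈ : ∀ c k w → 1 ≤ w → w ≤ k → (w , c) ∈ star c k
star-∈ c zero    zero    ()  _
star-∈ c zero    (suc w) _   ()
star-∈ c (suc k) w 1≤w w≤k+1 with w ≟ suc k
... | yes refl = here refl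
... | no  w≢k+1 = there (star-∈ c k w 1≤w (s≤s⁻¹ (≤∧≢⇒< w≤k+1 w≢k+1)))

-- In C_{c+1} plus the star from c to 1, ..., q, the vertex c has the q + 2 neighbours
-- 0, 1, ..., q, c - 1; so all vertices but c form a (q + 2)-dominating set.
star-dominating : ∀ q c → suc (suc q) ≤ c →
  IsPDom (suc (suc q)) (cycle (suc c) +E edges (star c q)) (labelSet (λ u → not (u ≡ᵇ c)))
star-dominating q (suc c') q+2≤c x x∉D = begin
    suc (suc q)                                           ≤⟨ ∑-initial+1 n (suc q) f y q+1≤n q+1≤y initial y-counts ⟩
    ∑ n f                                                 ≡⟨ degIn-labels n H d x ⟨
    degIn (cycle n +E edges (star c q)) (labelSet d) x   ∎
  where
  open ≤-Reasoning
  c = suc c'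
  n = suc c
  H : ℕ → ℕ → Bool
  H u v = cycleℕ n u v ∨ edgesℕ (star c q) u v
  d : ℕ → Bool
  d u = not (u ≡ᵇ c)
  f : Fin n → ℕ
  f j = ind (H (toℕ x) (toℕ j) ∧ d (toℕ j))
  x≡c : toℕ x ≡ c
  x≡c = ≡ᵇ-true (not-false (labelSet-∉ d x x∉D))
  q+1≤n : suc q ≤ n
  q+1≤n = ≤-trans (n≤1+n _) (≤-trans q+2≤c (n≤1+n _))
  y : Fin n
  y = fromℕ< (≤-trans (n<1+n c') (n≤1+n c))
  y-label : toℕ y ≡ c'
  y-label = FP.toℕ-fromℕ< _
  q+1≤y : suc q ≤ toℕ y
  q+1≤y = subst (suc q ≤_) (sym y-label) (s≤s⁻¹ q+2≤c)
  hit : ∀ j → toℕ j ≢ c → H c (toℕ j) ≡ true → 1 ≤ f j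
  hit j j≢c adjacent rewrite x≡c | adjacent | ≡ᵇ-false j≢c = ≤-refl
  initial : ∀ j → toℕ j < suc q → 1 ≤ f j
  initial j j≤q = hit j (λ j≡c → <-irrefl j≡c (≤-trans j≤q (≤-trans (n≤1+n _) q+2≤c))) (adjacent (toℕ j) j≤q)
    where
    adjacent : ∀ v → v < suc q → H c v ≡ true
    adjacent zero    _     = ∨-introˡ _ (cycle-close n c refl)
    adjacent (suc w) w<q+1 = ∨-introʳ _ (trans (edgesℕ-sym (star c q) c (suc w))
                                          (edgesℕ-∈ (star c q) (star-∈ c q (suc w) (s≤s z≤n) (s≤s⁻¹ w<q+1))))
  y-counts : 1 ≤ f y
  y-counts = hit y (λ y≡c → <-irrefl (trans (sym y-label) y≡c) (n<1+n c'))
    (subst (λ v → H c v ≡ true) (sym y-label) (∨-introˡ _ (cycle-prev n c')))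

star-reinforces : ∀ q c → suc (suc q) ≤ c → IsGammaP (suc (suc q)) (cycle (suc c)) (suc c) →
  Σ (Graph (suc c)) λ B → IsComplEdgeSet (cycle (suc c)) B × Reinforces (suc (suc q)) (cycle (suc c)) B × edgeCount B ≤ q
star-reinforces q c q+2≤c γ =
  edges (star c q) , edges-complement (suc c) _ nonEdges ,
  reinforces-by (suc (suc q)) (cycle (suc c)) (edges (star c q)) (labelSet (λ u → not (u ≡ᵇ c))) γ
    (star-dominating q c q+2≤c) (labelSet-missing (suc c) (λ u → not (u ≡ᵇ c)) (n<1+n c) (cong not (≡ᵇ-refl c))) ,
  subst (edgeCount {suc c} (edges (star c q)) ≤_) (star-length c q) (edges-count (suc c) _ (All.map proj₁ nonEdges))
  where
  nonEdges : All (NonEdge (suc c)) (star c q)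
  nonEdges = star-nonEdges c q q+2≤c

-- For p ≥ 3 we have γ_p(C_n) = n, so γ_p(C_n) > p allows the star with p - 2 edges.
large-p-upper : ∀ n p → 3 ≤ p → ∀ {k} → IsGammaP p (cycle n) k → p < k →
  Σ (Graph n) λ B → IsComplEdgeSet (cycle n) B × Reinforces p (cycle n) B × edgeCount B ≤ p ∸ 2
large-p-upper n p 3≤p γk p<k with refl ← γ-cycle-large-p n p 3≤p γk = by-star n p 3≤p p<k γk
  where
  by-star : ∀ n p → 3 ≤ p → p < n → IsGammaP p (cycle n) n →
    Σ (Graph n) λ B → IsComplEdgeSet (cycle n) B × Reinforces p (cycle n) B × edgeCount B ≤ p ∸ 2
  by-star (suc c) (suc (suc q)) _ (s≤s q+2≤c) = star-reinforces q c q+2≤c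
  by-star (suc c) (suc zero) (s≤s ()) _

large-p : ∀ n p → 3 ≤ p → (∃ λ g → IsGammaP p (cycle n) g × p < g) → IsReinforcementNumber p (cycle n) (p ∸ 2)
large-p n p 3≤p γ@(_ , γg , p<g) =
  reinforcement-number p (cycle n) (p ∸ 2) γ (large-p-upper n p 3≤p γg p<g) (reinforcement-lower n p)

across : ∀ {n} → (Fin n → Bool) → Graph n → Graph n
across d R x y = not (d x) ∧ R x y ∧ d y

outside inside : ∀ n → (Fin n → Bool) → ℕ
outside n d = ∑ n (λ i → ind (not (d i)))
inside  n d = ∑ n (λ i → ind (d i))

across-dominating : ∀ {n} p (H : Graph n) (D : Subset n) → IsPDom p H D →
  p * outside n (lookup D) ≤ arcs (across (lookup D) H)
across-dominating {n} p H D dom = ≤-trans (≤-reflexive (sym (∑-scale n p _))) (∑-mono n count)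
  where
  count : ∀ x → p * ind (not (lookup D x)) ≤ ∑ n (λ y → ind (across (lookup D) H x y))
  count x with lookup D x in x∉D
  ... | true  = ≤-trans (≤-reflexive (*-zeroʳ p)) z≤n
  ... | false = ≤-trans (≤-reflexive (*-identityʳ p)) (≤-trans (dom x x∉D) (≤-reflexive (sum-allFin n _)))

across-union : ∀ {n} (d : Fin n → Bool) (H G B : Graph n) → (∀ x y → H x y ≡ true → (G x y ∨ B x y) ≡ true) →
  arcs (across d H) ≤ arcs (across d G) + arcs (across d B)
across-union {n} d H G B H⊆G∪B =
  ≤-trans (∑²-mono n (λ x y → pointwise (not (d x)) (d y) (H⊆G∪B x y))) (≤-reflexive (∑²-+ n _ _))
  where
  pointwise : ∀ o i {h g b} → (h ≡ true → (g ∨ b) ≡ true) → ind (o ∧ h ∧ i) ≤ ind (o ∧ g ∧ i) + ind (o ∧ b ∧ i)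
  pointwise false _     _ = z≤n
  pointwise true  false {h} _ rewrite BP.∧-zeroʳ h = z≤n
  pointwise true  true  {false} _ = z≤n
  pointwise true  true  {true} {true}  _ = s≤s z≤n
  pointwise true  true  {true} {false} {true} _ = ≤-refl
  pointwise true  true  {true} {false} {false} h→g∨b with () ← h→g∨b refl

-- Counted from their end in d, the pairs across d in C_n number at most 2 per vertex of d.
across-cycle : ∀ n (d : Fin n → Bool) → arcs (across d (cycle n)) ≤ 2 * inside n d
across-cycle n d = begin
    arcs (across d (cycle n))                  ≤⟨ ∑²-mono n (λ x y → backwards (d x) (d y) (cycle n x y) (cycle-sym x y)) ⟩
    ∑² n (λ x y → ind (d y ∧ cycle n y x))     ≡⟨ ∑-swap n n _ ⟩
    ∑² n (λ y x → ind (d y ∧ cycle n y x))     ≤⟨ ∑-mono n degree ⟩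
    ∑ n (λ y → 2 * ind (d y))                  ≡⟨ ∑-scale n 2 _ ⟩
    2 * inside n d                             ∎
  where
  open ≤-Reasoning
  cycle-sym : ∀ x y → cycle n x y ≡ cycle n y x
  cycle-sym x y = BP.∨-comm (isSucc n x y) _
  backwards : ∀ a b c {c'} → c ≡ c' → ind (not a ∧ c ∧ b) ≤ ind (b ∧ c')
  backwards true  b     c _    = z≤n
  backwards false true  c refl = ≤-reflexive (cong ind (BP.∧-identityʳ c))
  backwards false false c _    rewrite BP.∧-zeroʳ c = z≤n
  degree : ∀ y → ∑ n (λ x → ind (d y ∧ cycle n y x)) ≤ 2 * ind (d y)
  degree y with d y
  ... | true  = cycle-degree n y
  ... | false = ≤-reflexive (∑-zero n (λ _ → refl))

-- Pairs across d form an asymmetric relation, so those in a symmetric B number at most |B|.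
across-edges : ∀ {n} (d : Fin n → Bool) (B : Graph n) → (∀ i j → B i j ≡ B j i) → arcs (across d B) ≤ edgeCount B
across-edges d B symmetric = asymmetric-arcs B (across d B) symmetric inB asym
  where
  inB : ∀ x y → across d B x y ≡ true → B x y ≡ true
  inB x y e = proj₁ (∧-true {B x y} (proj₂ (∧-true {not (d x)} e)))
  asym : ∀ x y → across d B x y ≡ true → across d B y x ≡ false
  asym x y e with d y | proj₂ (∧-true {B x y} (proj₂ (∧-true {not (d x)} e)))
  ... | true | _ = refl

-- Double counting for p = 2: if D is 2-dominating in a graph H ⊆ C_n ∪ B, counting the pairs
-- across D gives 2 (n - |D|) ≤ 2 |D| + |B|.
double-count : ∀ n (H B : Graph n) (D : Subset n) → (∀ i j → B i j ≡ B j i) →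
  (∀ x y → H x y ≡ true → (cycle n x y ∨ B x y) ≡ true) → IsPDom 2 H D →
  2 * n ≤ 4 * ∣ D ∣ + edgeCount B
double-count n H B D symmetric H⊆C∪B dom = begin
    2 * n                                                ≡⟨ cong (2 *_) (∑-complement n d) ⟨
    2 * (outside n d + inside n d)                       ≡⟨ *-distribˡ-+ 2 (outside n d) _ ⟩
    2 * outside n d + 2 * inside n d                     ≤⟨ +-monoˡ-≤ _ (across-dominating 2 H D dom) ⟩
    arcs (across d H) + 2 * inside n d                   ≤⟨ +-monoˡ-≤ _ (across-union d H (cycle n) B H⊆C∪B) ⟩
    arcs (across d (cycle n)) + arcs (across d B) + 2 * inside n d
                                                         ≤⟨ +-monoˡ-≤ _ (+-mono-≤ (across-cycle n d) (across-edges d B symmetric)) ⟩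
    2 * inside n d + edgeCount B + 2 * inside n d        ≡⟨ rearrange (inside n d) (edgeCount B) ⟩
    4 * inside n d + edgeCount B                         ≡⟨ cong (λ m → 4 * m + edgeCount B) (size-∑ D) ⟨
    4 * ∣ D ∣ + edgeCount B                               ∎
  where
  open ≤-Reasoning
  d : Fin n → Bool
  d = lookup D
  rearrange : ∀ a b → 2 * a + b + 2 * a ≡ 4 * a + b
  rearrange = solve-∀

-- Lower bound γ₂(C_n) ≥ n / 2: double counting with no extra edges.
γ₂-lower : ∀ n {g} → IsGammaP 2 (cycle n) g → 2 * n ≤ 4 * g
γ₂-lower n ((D , domD , refl) , _) =
  subst (2 * n ≤_) (trans (cong (4 * ∣ D ∣ +_) no-edges) (+-identityʳ _))
    (double-count n (cycle n) (edges []) D (λ _ _ → refl) (λ x y e → ∨-introˡ false e) domD)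
  where
  no-edges : edgeCount {n} (edges []) ≡ 0
  no-edges = n≤0⇒n≡0 (edges-count n [] [])

even : ℕ → Bool
even zero          = true
even (suc zero)    = false
even (suc (suc k)) = even k

odd : ℕ → Bool
odd u = even (suc u)

even-suc : ∀ k → even (suc k) ≡ not (even k)
even-suc zero          = refl
even-suc (suc zero)    = refl
even-suc (suc (suc k)) = even-suc k

even-%2 : ∀ n → n % 2 ≡ 0 → even n ≡ true
even-%2 zero          _ = refl
even-%2 (suc (suc n)) e = even-%2 n e

odd-%2 : ∀ n → n % 2 ≡ 1 → even n ≡ false
odd-%2 (suc zero)    _ = refl
odd-%2 (suc (suc n)) e = odd-%2 n e

even-pred : ∀ k → even (suc k) ≡ false → even k ≡ true
even-pred k e = not-false (trans (sym (even-suc k)) e)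

next-odd : ∀ k → even k ≡ true → even (suc k) ≡ false
next-odd k k-even = trans (even-suc k) (cong not k-even)

next-even : ∀ k → even k ≡ false → even (suc k) ≡ true
next-even k k-odd = trans (even-suc k) (cong not k-odd)

double-even : ∀ a → even (2 * a) ≡ true
double-even zero    = refl
double-even (suc a) rewrite +-suc a (a + 0) = double-even a

double≢odd : ∀ a m → even m ≡ false → 2 * a ≢ m
double≢odd a m odd-m refl with () ← trans (sym (double-even a)) odd-m

parity-count : ∀ n → (2 * ∑ n (λ i → ind (even (toℕ i))) ≤ suc n) × (2 * ∑ n (λ i → ind (odd (toℕ i))) ≤ n)
parity-count zero    = z≤n , z≤n
parity-count (suc n) with evens≤ , odds≤ ← parity-count n =
  subst (_≤ suc (suc n)) (sym (*-distribˡ-+ 2 1 _)) (s≤s (s≤s odds≤)) , evens≤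

record TwoNeighbours (n : ℕ) (H : ℕ → ℕ → Bool) (d : ℕ → Bool) (u : ℕ) : Set where
  constructor neighbours
  field
    a b : ℕ
    a<n : a < n
    b<n : b < n
    a≢b : a ≢ b
    Hua : H u a ≡ true
    da  : d a ≡ true
    Hub : H u b ≡ true
    db  : d b ≡ true

two-neighbours-dominate : ∀ n (H : ℕ → ℕ → Bool) (d : ℕ → Bool) →
  (∀ u → u < n → d u ≡ false → TwoNeighbours n H d u) →
  IsPDom {n} 2 (λ i j → H (toℕ i) (toℕ j)) (labelSet d)
two-neighbours-dominate n H d has2 x x∉D with has2 (toℕ x) (FP.toℕ<n x) (labelSet-∉ d x x∉D)
... | neighbours a b a<n b<n a≢b Hua da Hub db = begin
    2                        ≡⟨ cong₂ _+_ (counts a<n Hua da) (counts b<n Hub db) ⟨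
    f (fromℕ< a<n) + f (fromℕ< b<n) ≤⟨ ∑-two n _ _ f (λ e → a≢b (trans (sym (FP.toℕ-fromℕ< a<n)) (trans (cong toℕ e) (FP.toℕ-fromℕ< b<n)))) ⟩
    ∑ n f                    ≡⟨ degIn-labels n H d x ⟨
    degIn (λ i j → H (toℕ i) (toℕ j)) (labelSet d) x ∎
  where
  open ≤-Reasoning
  f : Fin n → ℕ
  f j = ind (H (toℕ x) (toℕ j) ∧ d (toℕ j))
  counts : ∀ {v} (v<n : v < n) → H (toℕ x) v ≡ true → d v ≡ true → f (fromℕ< v<n) ≡ 1
  counts v<n Hxv dv rewrite FP.toℕ-fromℕ< v<n = ind-true Hxv dv

-- The even labels form a 2-dominating set of C_n (n ≥ 3): an odd u has the even neighbours
-- u - 1 and u + 1, read as 0 when u = n - 1.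
alternating-dominates : ∀ n → 3 ≤ n → IsPDom 2 (cycle n) (labelSet even)
alternating-dominates n 3≤n = two-neighbours-dominate n (cycleℕ n) even has2
  where
  has2 : ∀ u → u < n → even u ≡ false → TwoNeighbours n (cycleℕ n) even u
  has2 (suc a) u<n u-odd with even-a ← even-pred a u-odd with suc (suc a) <? n
  ... | yes a+2<n = neighbours a (suc (suc a)) (≤-trans (n≤1+n _) u<n) a+2<n (λ ()) (cycle-prev n a) even-a (cycle-next n (suc a)) even-a
  ... | no  a+2≮n = neighbours a 0 (≤-trans (n≤1+n _) u<n) (≤-trans (s≤s z≤n) u<n) a≢0 (cycle-prev n a) even-a
                      (cycle-close n (suc a) a+2≡n) refl
    where
    a+2≡n : suc (suc a) ≡ n
    a+2≡n = ≤-antisym u<n (≮⇒≥ a+2≮n)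
    a≢0 : a ≢ 0
    a≢0 refl = <-irrefl a+2≡n 3≤n

γ₂-upper : ∀ n → 3 ≤ n → ∀ {g} → IsGammaP 2 (cycle n) g → 2 * g ≤ suc n
γ₂-upper n 3≤n (_ , minimal) = ≤-trans
  (*-monoʳ-≤ 2 (subst (_ ≤_) (labelSet-size n even) (minimal (labelSet even) (alternating-dominates n 3≤n))))
  (proj₁ (parity-count n))

position : ∀ {n u} → u < n → suc u ≡ n ⊎ suc (suc u) ≡ n ⊎ suc (suc u) < n
position u<n with m≤n⇒m<n∨m≡n u<n
... | inj₂ last = inj₁ last
... | inj₁ u+1<n with m≤n⇒m<n∨m≡n u+1<n
...   | inj₂ second-last = inj₂ (inj₁ second-last)
...   | inj₁ inner       = inj₂ (inj₂ inner)

-- The dominating set of the reinforced cycles: the odd labels other than n - 1.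
oddBelow : ℕ → ℕ → Bool
oddBelow n u = odd u ∧ not (suc u ≡ᵇ n)

oddBelow-∈ : ∀ n u → odd u ≡ true → suc u ≢ n → oddBelow n u ≡ true
oddBelow-∈ n u odd-u u+1≢n rewrite odd-u | ≡ᵇ-false u+1≢n = refl

oddBelow-∉ : ∀ n u → oddBelow n u ≡ false → suc u ≢ n → odd u ≡ false
oddBelow-∉ n u u∉D u+1≢n rewrite ≡ᵇ-false u+1≢n = trans (sym (BP.∧-identityʳ _)) u∉D

-- In a graph H ⊇ C_n containing the edge 0–3 (n ≥ 5), a vertex u ∉ oddBelow n with u + 2 < n
-- has two neighbours in oddBelow n: 1 and 3 if u = 0, and u - 1, u + 1 otherwise.
inner-neighbours : ∀ n (H : ℕ → ℕ → Bool) → 5 ≤ n → (∀ u v → cycleℕ n u v ≡ true → H u v ≡ true) →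
  H 0 3 ≡ true → ∀ u → suc (suc u) < n → oddBelow n u ≡ false → TwoNeighbours n H (oddBelow n) u
inner-neighbours n H 5≤n C⊆H H03 zero _ _ =
  neighbours 1 3 (≤-trans (s≤s (s≤s z≤n)) 5≤n) (≤-trans (s≤s (s≤s (s≤s (s≤s z≤n)))) 5≤n) (λ ())
    (C⊆H 0 1 (cycle-next n 0)) (oddBelow-∈ n 1 refl (λ { refl → <-irrefl refl (≤-trans (s≤s (s≤s (s≤s z≤n))) 5≤n) }))
    H03                       (oddBelow-∈ n 3 refl (λ { refl → <-irrefl refl 5≤n }))
inner-neighbours n H 5≤n C⊆H H03 (suc a) a+3<n u∉D =
  neighbours a (suc (suc a)) (≤-trans (n≤1+n _) (<⇒≤ (≤-trans (n≤1+n _) a+3<n))) (<⇒≤ a+3<n) (λ ())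
    (C⊆H (suc a) a (cycle-prev n a))             (oddBelow-∈ n a odd-a (λ { refl → <-irrefl refl (≤-trans (n≤1+n _) (<⇒≤ a+3<n)) }))
    (C⊆H (suc a) (suc (suc a)) (cycle-next n (suc a))) (oddBelow-∈ n (suc (suc a)) odd-a (<⇒≢ a+3<n))
  where
  -- u = a + 1 is even because it lies outside oddBelow n and is not n - 1.
  odd-a : odd a ≡ true
  odd-a = next-even a (oddBelow-∉ n (suc a) u∉D (<⇒≢ (≤-trans (n≤1+n _) a+3<n)))

C⊆C+E : ∀ n ps u v → cycleℕ n u v ≡ true → (cycleℕ n u v ∨ edgesℕ ps u v) ≡ true
C⊆C+E n ps u v = ∨-introˡ _

E⊆C+E : ∀ n ps {u v} → (u , v) ∈ ps ⊎ (v , u) ∈ ps → (cycleℕ n u v ∨ edgesℕ ps u v) ≡ true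
E⊆C+E n ps         (inj₁ uv∈ps) = ∨-introʳ _ (edgesℕ-∈ ps uv∈ps)
E⊆C+E n ps {u} {v} (inj₂ vu∈ps) = ∨-introʳ _ (trans (edgesℕ-sym ps u v) (edgesℕ-∈ ps vu∈ps))

oddBelow-size : ∀ n → 2 * ∣ labelSet {n} (oddBelow n) ∣ ≤ n
oddBelow-size n = begin
    2 * ∣ labelSet {n} (oddBelow n) ∣          ≡⟨ cong (2 *_) (labelSet-size n (oddBelow n)) ⟩
    2 * ∑ n (λ i → ind (oddBelow n (toℕ i)))  ≤⟨ *-monoʳ-≤ 2 (∑-mono n (λ i → ind-∧ (odd (toℕ i)) _)) ⟩
    2 * ∑ n (λ i → ind (odd (toℕ i)))          ≤⟨ proj₂ (parity-count n) ⟩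
    n                                          ∎
  where open ≤-Reasoning

half : ∀ {n g} → 2 * n ≤ 4 * g → n ≤ 2 * g
half {n} {g} le = *-cancelˡ-≤ 2 (subst (2 * n ≤_) (four g) le)
  where
  four : ∀ g → 4 * g ≡ 2 * (2 * g)
  four = solve-∀

oddEdges : ℕ → List (ℕ × ℕ)
oddEdges t = (0 , 3) ∷ (1 , 4 + t) ∷ []

oddEdges-nonEdges : ∀ t → All (NonEdge (5 + t)) (oddEdges t)
oddEdges-nonEdges t = (s≤s z≤n , (λ ()) , (λ _ ())) ∷ (s≤s (s≤s z≤n) , (λ ()) , (λ ())) ∷ []

-- For odd n = t + 5, oddBelow n is 2-dominating in C_n plus 0–3 and 1–(n-1); in particular
-- the even vertex n - 1 is adjacent to n - 2 and 1.
odd-dominating : ∀ t → even (5 + t) ≡ false →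
  IsPDom 2 (cycle (5 + t) +E edges (oddEdges t)) (labelSet (oddBelow (5 + t)))
odd-dominating t n-odd = two-neighbours-dominate n H (oddBelow n) has2
  where
  n = 5 + t
  ps = oddEdges t
  H : ℕ → ℕ → Bool
  H u v = cycleℕ n u v ∨ edgesℕ ps u v
  n-2∈D : oddBelow n (3 + t) ≡ true
  n-2∈D = oddBelow-∈ n (3 + t) (even-pred t n-odd) (λ ())
  has2 : ∀ u → u < n → oddBelow n u ≡ false → TwoNeighbours n H (oddBelow n) u
  has2 u u<n u∉D with position u<n
  ... | inj₁ refl = neighbours (3 + t) 1 (n≤1+n _) (s≤s (s≤s z≤n)) (λ ())
        (C⊆C+E n ps (4 + t) (3 + t) (cycle-prev n (3 + t)))  n-2∈D
        (E⊆C+E n ps {4 + t} {1} (inj₂ (there (here refl))))   (oddBelow-∈ n 1 refl (λ ()))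
  ... | inj₂ (inj₁ refl) with () ← trans (sym u∉D) n-2∈D
  ... | inj₂ (inj₂ inner) = inner-neighbours n H (s≤s (s≤s (s≤s (s≤s (s≤s z≤n))))) (C⊆C+E n ps)
                              (E⊆C+E n ps {0} {3} (inj₁ (here refl))) u inner u∉D

odd-reinforces : ∀ t → even (5 + t) ≡ false → ∀ {k} → IsGammaP 2 (cycle (5 + t)) k →
  Σ (Graph (5 + t)) λ B → IsComplEdgeSet (cycle (5 + t)) B × Reinforces 2 (cycle (5 + t)) B × edgeCount B ≤ 2
odd-reinforces t n-odd {k} γk =
  edges (oddEdges t) , edges-complement (5 + t) _ (oddEdges-nonEdges t) ,
  reinforces-by 2 (cycle (5 + t)) _ D γk (odd-dominating t n-odd)
    (*-cancelˡ-< 2 ∣ D ∣ k (<-≤-trans small (half {5 + t} {k} (γ₂-lower (5 + t) γk)))) ,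
  edges-count (5 + t) (oddEdges t) (All.map proj₁ (oddEdges-nonEdges t))
  where
  D : Subset (5 + t)
  D = labelSet (oddBelow (5 + t))
  -- 2 |D| ≤ n, and equality is impossible as n is odd.
  small : 2 * ∣ D ∣ < 5 + t
  small = ≤∧≢⇒< (oddBelow-size (5 + t)) (double≢odd ∣ D ∣ (5 + t) n-odd)

evenEdges : ℕ → List (ℕ × ℕ)
evenEdges t = (0 , 3) ∷ (1 , 5 + t) ∷ (3 , 5 + t) ∷ (1 , 4 + t) ∷ []

evenEdges-nonEdges : ∀ t → All (NonEdge (6 + t)) (evenEdges t)
evenEdges-nonEdges t =
  (s≤s z≤n , (λ ()) , (λ _ ())) ∷ (s≤s (s≤s z≤n) , (λ ()) , (λ ())) ∷
  (s≤s (s≤s (s≤s (s≤s z≤n))) , (λ ()) , (λ ())) ∷ (s≤s (s≤s z≤n) , (λ ()) , (λ ())) ∷ []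

-- For even n = t + 6, oddBelow n is 2-dominating in C_n plus the four edges of evenEdges:
-- n - 1 is adjacent to 1 and 3, and n - 2 to n - 3 and 1.
even-dominating : ∀ t → even t ≡ true →
  IsPDom 2 (cycle (6 + t) +E edges (evenEdges t)) (labelSet (oddBelow (6 + t)))
even-dominating t t-even = two-neighbours-dominate n H (oddBelow n) has2
  where
  n = 6 + t
  ps = evenEdges t
  H : ℕ → ℕ → Bool
  H u v = cycleℕ n u v ∨ edgesℕ ps u v
  1∈D : oddBelow n 1 ≡ true
  1∈D = oddBelow-∈ n 1 refl (λ ())
  has2 : ∀ u → u < n → oddBelow n u ≡ false → TwoNeighbours n H (oddBelow n) u
  has2 u u<n u∉D with position u<n
  ... | inj₁ refl = neighbours 1 3 (s≤s (s≤s z≤n)) (s≤s (s≤s (s≤s (s≤s z≤n)))) (λ ())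
        (E⊆C+E n ps {5 + t} {1} (inj₂ (there (here refl))))          1∈D
        (E⊆C+E n ps {5 + t} {3} (inj₂ (there (there (here refl)))))  (oddBelow-∈ n 3 refl (λ ()))
  ... | inj₂ (inj₁ refl) = neighbours (3 + t) 1 (≤-trans (n≤1+n _) (n≤1+n _)) (s≤s (s≤s z≤n)) (λ ())
        (C⊆C+E n ps (4 + t) (3 + t) (cycle-prev n (3 + t)))                  (oddBelow-∈ n (3 + t) t-even (λ ()))
        (E⊆C+E n ps {4 + t} {1} (inj₂ (there (there (there (here refl)))))) 1∈D
  ... | inj₂ (inj₂ inner) = inner-neighbours n H (s≤s (s≤s (s≤s (s≤s (s≤s z≤n))))) (C⊆C+E n ps)
                              (E⊆C+E n ps {0} {3} (inj₁ (here refl))) u inner u∉D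

even-reinforces : ∀ t → even t ≡ true → ∀ {k} → IsGammaP 2 (cycle (6 + t)) k →
  Σ (Graph (6 + t)) λ B → IsComplEdgeSet (cycle (6 + t)) B × Reinforces 2 (cycle (6 + t)) B × edgeCount B ≤ 4
even-reinforces t t-even {k} γk =
  edges (evenEdges t) , edges-complement (6 + t) _ (evenEdges-nonEdges t) ,
  reinforces-by 2 (cycle (6 + t)) _ D γk (even-dominating t t-even)
    (*-cancelˡ-≤ 2 (≤-trans small (half {6 + t} {k} (γ₂-lower (6 + t) γk)))) ,
  edges-count (6 + t) (evenEdges t) (All.map proj₁ (evenEdges-nonEdges t))
  where
  D : Subset (6 + t)
  D = labelSet (oddBelow (6 + t))
  -- D misses the odd label n - 1, so 2 (|D| + 1) is at most twice the number of odd labels, i.e. n.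
  small : 2 * suc ∣ D ∣ ≤ 6 + t
  small = ≤-trans (*-monoʳ-≤ 2 D+1≤odd) (proj₂ (parity-count (6 + t)))
    where
    n-1 : Fin (6 + t)
    n-1 = fromℕ< (n<1+n (5 + t))
    D+1≤odd : suc ∣ D ∣ ≤ ∑ (6 + t) (λ i → ind (odd (toℕ i)))
    D+1≤odd = subst (_≤ ∑ (6 + t) (λ i → ind (odd (toℕ i)))) (trans (cong (_+ 1) (sym (labelSet-size (6 + t) (oddBelow (6 + t))))) (+-comm _ 1))
      (∑-pick (6 + t) n-1 {λ i → ind (oddBelow (6 + t) (toℕ i))} {λ i → ind (odd (toℕ i))} 1
        (λ i _ → ind-∧ (odd (toℕ i)) _) missing-n-1)
      where
      missing-n-1 : ind (oddBelow (6 + t) (toℕ n-1)) + 1 ≤ ind (odd (toℕ n-1))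
      missing-n-1 = subst (λ v → ind (oddBelow (6 + t) v) + 1 ≤ ind (odd v)) (sym (FP.toℕ-fromℕ< (n<1+n (5 + t)))) last-odd
        where
        last-odd : ind (oddBelow (6 + t) (5 + t)) + 1 ≤ ind (odd (5 + t))
        last-odd rewrite ≡ᵇ-refl t | BP.∧-zeroʳ (odd (5 + t)) | t-even = ≤-refl

reinforced-count : ∀ n B → IsComplEdgeSet (cycle n) B → Reinforces 2 (cycle n) B →
  ∃ λ k → ∃ λ k' → IsGammaP 2 (cycle n) k × suc k' ≤ k × 2 * n ≤ 4 * k' + edgeCount B
reinforced-count n B ((symmetric , _) , _) (k , _ , γk , ((D , domD , refl) , _) , D<k) =
  k , ∣ D ∣ , γk , D<k , double-count n (cycle n +E B) B D symmetric (λ _ _ e → e) domD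

gap : ∀ n s {k k'} e → 2 * k ≤ n + s → 2 * n ≤ 4 * k' + e → suc k' ≤ k → 4 ≤ e + 2 * s
gap n s {k} {k'} e 2k≤n+s 2n≤4k'+e k'<k = +-cancelˡ-≤ (4 * k') 4 (e + 2 * s) (begin
    4 * k' + 4          ≡⟨ four k' ⟩
    2 * (2 * suc k')    ≤⟨ *-monoʳ-≤ 2 (≤-trans (*-monoʳ-≤ 2 k'<k) 2k≤n+s) ⟩
    2 * (n + s)         ≡⟨ *-distribˡ-+ 2 n s ⟩
    2 * n + 2 * s       ≤⟨ +-monoˡ-≤ (2 * s) 2n≤4k'+e ⟩
    4 * k' + e + 2 * s  ≡⟨ +-assoc (4 * k') e (2 * s) ⟩
    4 * k' + (e + 2 * s) ∎)
  where
  open ≤-Reasoning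
  four : ∀ m → 4 * m + 4 ≡ 2 * (2 * suc m)
  four = solve-∀

-- Lower bound for p = 2: every reinforcing set has at least 2 edges, as γ₂(C_n) ≤ (n + 1) / 2.
two-lower : ∀ n → 3 ≤ n → ∀ B → IsComplEdgeSet (cycle n) B → Reinforces 2 (cycle n) B → 2 ≤ edgeCount B
two-lower n 3≤n B complB reinforcesB with k , k' , γk , k'<k , count ← reinforced-count n B complB reinforcesB =
  +-cancelʳ-≤ 2 2 (edgeCount B) (gap n 1 (edgeCount B) (subst (2 * k ≤_) (+-comm 1 n) (γ₂-upper n 3≤n γk)) count k'<k)

-- Lower bound for p = 2 and even n: at least 4 edges, as then γ₂(C_n) ≤ n / 2.
four-lower : ∀ n → 3 ≤ n → even n ≡ true → ∀ B → IsComplEdgeSet (cycle n) B → Reinforces 2 (cycle n) B →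
  4 ≤ edgeCount B
four-lower n 3≤n n-even B complB reinforcesB with k , k' , γk , k'<k , count ← reinforced-count n B complB reinforcesB =
  subst (4 ≤_) (+-identityʳ (edgeCount B)) (gap n 0 (edgeCount B) 2k≤n count k'<k)
  where
  2k≤n : 2 * k ≤ n + 0
  2k≤n = subst (2 * k ≤_) (sym (+-identityʳ n))
    (s≤s⁻¹ (≤∧≢⇒< (γ₂-upper n 3≤n γk) (double≢odd k (suc n) (next-odd n n-even))))

two-odd : ∀ n → 3 ≤ n → n % 2 ≡ 1 → (∃ λ g → IsGammaP 2 (cycle n) g × 2 < g) → IsReinforcementNumber 2 (cycle n) 2
two-odd n 3≤n n%2≡1 γ@(g , γg , 2<g) =
  reinforcement-number 2 (cycle n) 2 γ (upper n 5≤n (odd-%2 n n%2≡1) γg) (two-lower n 3≤n)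
  where
  -- 6 ≤ 2γ₂(C_n) ≤ n + 1.
  5≤n : 5 ≤ n
  5≤n = s≤s⁻¹ (≤-trans (*-monoʳ-≤ 2 2<g) (γ₂-upper n 3≤n γg))
  upper : ∀ n → 5 ≤ n → even n ≡ false → IsGammaP 2 (cycle n) g →
    Σ (Graph n) λ B → IsComplEdgeSet (cycle n) B × Reinforces 2 (cycle n) B × edgeCount B ≤ 2
  upper (suc (suc (suc (suc (suc t))))) (s≤s (s≤s (s≤s (s≤s (s≤s _))))) n-odd = odd-reinforces t n-odd

two-even : ∀ n → 3 ≤ n → n % 2 ≡ 0 → (∃ λ g → IsGammaP 2 (cycle n) g × 2 < g) → IsReinforcementNumber 2 (cycle n) 4
two-even n 3≤n n%2≡0 γ@(g , γg , 2<g) =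
  reinforcement-number 2 (cycle n) 4 γ (upper n 6≤n (even-%2 n n%2≡0) γg) (four-lower n 3≤n (even-%2 n n%2≡0))
  where
  -- 6 ≤ 2γ₂(C_n) ≤ n + 1, and n + 1 is odd.
  6≤n : 6 ≤ n
  6≤n = s≤s⁻¹ (≤∧≢⇒< (≤-trans (*-monoʳ-≤ 2 2<g) (γ₂-upper n 3≤n γg))
          (double≢odd 3 (suc n) (next-odd n (even-%2 n n%2≡0))))
  upper : ∀ n → 6 ≤ n → even n ≡ true → IsGammaP 2 (cycle n) g →
    Σ (Graph n) λ B → IsComplEdgeSet (cycle n) B × Reinforces 2 (cycle n) B × edgeCount B ≤ 4
  upper (suc (suc (suc (suc (suc (suc t)))))) (s≤s (s≤s (s≤s (s≤s (s≤s (s≤s _)))))) t-even = even-reinforces t t-even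

theorem3p3 : (p n : ℕ) → 2 ≤ p → 3 ≤ n →
    (Σ ℕ λ g → IsGammaP p (cycle n) g × p < g) →
    (p ≡ 2 → n % 2 ≡ 1 → IsReinforcementNumber p (cycle n) 2) ×
    (p ≡ 2 → n % 2 ≡ 0 → IsReinforcementNumber p (cycle n) 4) ×
    (3 ≤ p → IsReinforcementNumber p (cycle n) (p ∸ 2))
theorem3p3 p n _ 3≤n γ =
  (λ { refl n%2≡1 → two-odd n 3≤n n%2≡1 γ }) ,
  (λ { refl n%2≡0 → two-even n 3≤n n%2≡0 γ }) ,
  (λ 3≤p → large-p n p 3≤p γ)
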